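{- Let $n, l$ be positive integers, $p$ a prime and $j \geq 0$ an integer. Write $n = q p^k$ with $k \geq 0$ an integer and $p \nmid q$, and set $$\alpha'(n,p) = nj + 1 + k + \delta_{p,2}(1-\delta_{k,0}),$$ where $\delta$ is the Kronecker delta. Let $X_{l,p} = \{x' \in \mathbb{Z} : 0 \leq x' < p^l\}$. Then for each integer $r$ with $0<r<p$, the map $C_{r} : X_{l,p} \to X_{l,p}$ given by $$C_{r}(x') = \left\lfloor \frac{\big(p^j(p x' + r)\big)^n}{p^{\alpha'(n,p)}} \right\rfloor \bmod p^l$$ is a bijection. Equivalently, as $x$ ranges over the $p^l$ numbers $x = p^j(px'+r)$, $x' \in X_{l,p}$, the $l$ base-$p$ digits of $x^n$ at the positions of $p^{\alpha'}, p^{\alpha'+1}, \dots, p^{\alpha'+l-1}$ take each value in $X_{l,p}$ exactly once.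
   Context: $\lfloor y \rfloor$ denotes the integer part (floor) of $y$; $a \bmod m$ is the least non-negative residue. Every positive integer $x$ can be written uniquely as $x = p^j(px'+r)$ with $j \geq 0$, $x' \geq 0$ and $0<r<p$. -}

module Defs where

open import Data.Nat using (ℕ; zero; suc; _+_; _∸_; _*_; _^_; _<_; NonZero)
open import Data.Nat.DivMod using (_/_; _%_; m%n<n)
open import Data.Nat.Properties using (m^n≢0)
open import Data.Fin using (Fin; toℕ; fromℕ<)

δ : ℕ → ℕ → ℕ
δ zero    zero    = 1
δ zero    (suc _) = 0
δ (suc _) zero    = 0
δ (suc a) (suc b) = δ a b

α′ : (n j k p : ℕ) → ℕ
α′ n j k p = n * j + 1 + k + δ p 2 * (1 ∸ δ k 0)

Dℕ : (p n j k r x′ : ℕ) → .{{NonZero p}} → ℕ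
Dℕ p n j k r x′ = _/_ ((p ^ j * (p * x′ + r)) ^ n) (p ^ α′ n j k p) {{m^n≢0 p (α′ n j k p)}}

Cℕ : (p n j k l r x′ : ℕ) → .{{NonZero p}} → ℕ
Cℕ p n j k l r x′ = _%_ (Dℕ p n j k r x′) (p ^ l) {{m^n≢0 p l}}

C : (p n j k l r : ℕ) → .{{_ : NonZero p}} → Fin (p ^ l) → Fin (p ^ l)
C p n j k l r x′ = fromℕ< (m%n<n (Dℕ p n j k r (toℕ x′)) (p ^ l) {{m^n≢0 p l}})

{-# OPTIONS --safe #-}
module Submission where

-- Cancelling p^{nj}, C_r(x') is the block of l base-p digits of y^n, y = p x' + r, starting at
-- position α₀ = 1 + k + [p = 2 and k > 0]. For x'₁ < x'₂ < p^l we have y₂ − y₁ = p^{s+1} u with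
-- p ∤ u and s < l, and lifting the exponent through n = q p^k gives v_p(y₂^n − y₁^n) = s + 1 + k.
-- When p = 2, k > 0 and s = 0, the same argument is applied to y₁ and −y₂ instead (n is even),
-- whose difference y₁ + y₂ is divisible by 4. In every case the valuation lies in [α₀, α₀ + l), so
-- the two digit blocks differ; an injective self-map of a finite set is a bijection.

module LiftingTheExponent where

  open import Data.Integer using (ℤ; +_; -_; _+_; _*_; _^_; 0ℤ; 1ℤ; ∣_∣; _⊖_)
  open import Data.Integer.Properties
    using (pos-+; pos-*; abs-*; ^-*-assoc; ^-identityʳ; ∣-i∣≡∣i∣; -m+n≡n⊖m; ⊖-≥; neg-distribʳ-*)
  open import Data.Integer.Divisibility.Signed
    using (_∣_; divides; ∣ᵤ⇒∣; ∣⇒∣ᵤ; ∣-refl; ∣m+n∣n⇒∣m; ∣m⇒∣m*n; ∣n⇒∣m*n)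
  open import Data.Integer.Tactic.RingSolver using (solve-∀)
  open import Data.Nat as ℕ using (ℕ; zero; suc; z≤n; s≤s)
  import Data.Nat.Properties as ℕ
  import Data.Nat.Divisibility as ℕ
  open import Data.Nat.Combinatorics using (nC1≡n; nCk+nC[k+1]≡[n+1]C[k+1]) renaming (_C_ to _choose_)
  open import Data.Nat.Primality using (Prime; euclidsLemma; ¬prime[1]; prime⇒nonTrivial)
  open import Data.Product using (_×_; _,_; ∃-syntax)
  open import Data.Sum using (inj₁; inj₂)
  open import Relation.Nullary using (¬_)
  open import Relation.Binary.PropositionalEquality
  open ≡-Reasoning

  pos-^ : ∀ m n → + (m ℕ.^ n) ≡ (+ m) ^ n
  pos-^ m zero    = refl
  pos-^ m (suc n) = trans (pos-* m (m ℕ.^ n)) (cong (+ m *_) (pos-^ m n))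

  ^-even : ∀ x c → (- x) ^ (2 ℕ.* c) ≡ x ^ (2 ℕ.* c)
  ^-even x c = begin
    (- x) ^ (2 ℕ.* c)   ≡⟨ ^-*-assoc (- x) 2 c ⟨
    ((- x) ^ 2) ^ c     ≡⟨ cong (_^ c) (square x) ⟩
    (x ^ 2) ^ c         ≡⟨ ^-*-assoc x 2 c ⟩
    x ^ (2 ℕ.* c)       ∎
    where square : ∀ x → - x * (- x * 1ℤ) ≡ x * (x * 1ℤ)
          square = solve-∀

  binomial-linear : ∀ n a d → ∃[ X ] (a + d) ^ n ≡ a ^ n + + n * a ^ (n ℕ.∸ 1) * d + X * d * d
  binomial-linear zero          a d = 0ℤ , base a d
    where base : ∀ a d → 1ℤ ≡ 1ℤ + 0ℤ * 1ℤ * d + 0ℤ * d * d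
          base = solve-∀
  binomial-linear (suc zero)    a d = 0ℤ , base a d
    where base : ∀ a d → (a + d) * 1ℤ ≡ a * 1ℤ + 1ℤ * 1ℤ * d + 0ℤ * d * d
          base = solve-∀
  binomial-linear (suc (suc m)) a d with X , expand ← binomial-linear (suc m) a d =
    X * a + + suc m * a ^ m + X * d , (begin
      (a + d) * (a + d) ^ suc m
        ≡⟨ cong ((a + d) *_) expand ⟩
      (a + d) * (a * A + c * A * d + X * d * d)
        ≡⟨ step a d A c X ⟩
      a * (a * A) + (1ℤ + c) * (a * A) * d + (X * a + c * A + X * d) * d * d
        ≡⟨ cong (λ e → a * (a * A) + e * (a * A) * d + (X * a + c * A + X * d) * d * d) (pos-+ 1 (suc m)) ⟨
      a * (a * A) + + suc (suc m) * (a * A) * d + (X * a + c * A + X * d) * d * d ∎)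
    where
      A = a ^ m
      c = + suc m
      step : ∀ a d A c X → (a + d) * (a * A + c * A * d + X * d * d)
           ≡ a * (a * A) + (1ℤ + c) * (a * A) * d + (X * a + c * A + X * d) * d * d
      step = solve-∀

  suc-choose-2 : ∀ n → suc n choose 2 ≡ n ℕ.+ n choose 2
  suc-choose-2 n = begin
    suc n choose 2               ≡⟨ nCk+nC[k+1]≡[n+1]C[k+1] n 1 ⟨
    n choose 1 ℕ.+ n choose 2    ≡⟨ cong (ℕ._+ n choose 2) (nC1≡n n) ⟩
    n ℕ.+ n choose 2             ∎

  binomial-quadratic : ∀ n a d → 2 ℕ.≤ n → ∃[ X ]
    (a + d) ^ n ≡ a ^ n + + n * a ^ (n ℕ.∸ 1) * d + + (n choose 2) * a ^ (n ℕ.∸ 2) * d * d + X * d * d * d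
  binomial-quadratic (suc zero) a d (s≤s ())
  binomial-quadratic (suc (suc zero)) a d _ = 0ℤ , base a d
    where base : ∀ a d → (a + d) * ((a + d) * 1ℤ)
               ≡ a * (a * 1ℤ) + (1ℤ + 1ℤ) * (a * 1ℤ) * d + 1ℤ * 1ℤ * d * d + 0ℤ * d * d * d
          base = solve-∀
  binomial-quadratic (suc (suc (suc m))) a d _
    with X , expand ← binomial-quadratic (suc (suc m)) a d (s≤s (s≤s z≤n)) =
    t * A + X * a + X * d , (begin
      (a + d) * (a + d) ^ suc (suc m)
        ≡⟨ cong ((a + d) *_) expand ⟩
      (a + d) * (a * (a * A) + c * (a * A) * d + t * A * d * d + X * d * d * d)
        ≡⟨ step a d A c t X ⟩
      a * (a * (a * A)) + (1ℤ + c) * (a * (a * A)) * d + (c + t) * (a * A) * d * d + X′ * d * d * d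
        ≡⟨ cong₂ (λ e f → a * (a * (a * A)) + e * (a * (a * A)) * d + f * (a * A) * d * d + X′ * d * d * d)
                 (pos-+ 1 (suc (suc m))) (trans (cong +_ (suc-choose-2 (suc (suc m)))) (pos-+ (suc (suc m)) _)) ⟨
      a * (a * (a * A)) + + suc (suc (suc m)) * (a * (a * A)) * d + + (suc (suc (suc m)) choose 2) * (a * A) * d * d + X′ * d * d * d ∎)
    where
      A = a ^ m
      c = + suc (suc m)
      t = + (suc (suc m) choose 2)
      X′ = t * A + X * a + X * d
      step : ∀ a d A c t X → (a + d) * (a * (a * A) + c * (a * A) * d + t * A * d * d + X * d * d * d)
           ≡ a * (a * (a * A)) + (1ℤ + c) * (a * (a * A)) * d + (c + t) * (a * A) * d * d + (t * A + X * a + X * d) * d * d * d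
      step = solve-∀

  record ExactDiff (p e : ℕ) (a b : ℤ) : Set where
    constructor exactDiff
    field
      cofactor    : ℤ
      difference  : b ≡ a + (+ p) ^ e * cofactor
      indivisible : ¬ (+ p ∣ cofactor)

  ExactDiff-resp : ∀ {p e e′ a a′ b b′} → e ≡ e′ → a ≡ a′ → b ≡ b′ → ExactDiff p e a b → ExactDiff p e′ a′ b′
  ExactDiff-resp refl refl refl d = d

  module _ {p : ℕ} (isPrime : Prime p) where

    private
      P : ℤ
      P = + p

    ∤-* : ∀ {a b} → ¬ P ∣ a → ¬ P ∣ b → ¬ P ∣ a * b
    ∤-* {a} {b} p∤a p∤b p∣ab with euclidsLemma ∣ a ∣ ∣ b ∣ isPrime (subst (p ℕ.∣_) (abs-* a b) (∣⇒∣ᵤ p∣ab))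
    ... | inj₁ p∣a = p∤a (∣ᵤ⇒∣ p∣a)
    ... | inj₂ p∣b = p∤b (∣ᵤ⇒∣ p∣b)

    ∤-^ : ∀ {a} n → ¬ P ∣ a → ¬ P ∣ a ^ n
    ∤-^ zero    _   p∣1 = ¬prime[1] (subst Prime (ℕ.∣1⇒≡1 (∣⇒∣ᵤ p∣1)) isPrime)
    ∤-^ (suc n) p∤a     = ∤-* p∤a (∤-^ n p∤a)

    ∤-+∣ : ∀ {a b} → ¬ P ∣ a → P ∣ b → ¬ P ∣ a + b
    ∤-+∣ p∤a p∣b p∣a+b = p∤a (∣m+n∣n⇒∣m p∣a+b p∣b)

    ∤-pos : ∀ {n} → ¬ p ℕ.∣ n → ¬ P ∣ + n
    ∤-pos p∤n p∣n = p∤n (∣⇒∣ᵤ p∣n)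

    exactDiff-^-coprime : ∀ {s a b} q → ¬ p ℕ.∣ q → ¬ P ∣ a →
      ExactDiff p (suc s) a b → ExactDiff p (suc s) (a ^ q) (b ^ q)
    exactDiff-^-coprime {s} {a} q p∤q p∤a (exactDiff u refl p∤u)
      with X , expand ← binomial-linear q a (P ^ suc s * u) =
      exactDiff ((c * A + X * (E * u)) * u)
        (trans expand (regroup (a ^ q) c A E u X))
        (∤-* (∤-+∣ (∤-* (∤-pos p∤q) (∤-^ (q ℕ.∸ 1) p∤a)) (∣n⇒∣m*n X (∣m⇒∣m*n u (∣m⇒∣m*n (P ^ s) ∣-refl)))) p∤u)
      where
        E = P ^ suc s
        c = + q
        A = a ^ (q ℕ.∸ 1)
        regroup : ∀ aq c A E u X → aq + c * A * (E * u) + X * (E * u) * (E * u) ≡ aq + E * ((c * A + X * (E * u)) * u)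
        regroup = solve-∀

    -- The binomial term C(p,2) a^{p-2} d² is divisible by p^{s+3} iff p ∣ C(p,2) p^s:
    -- always for odd p, but for p = 2 only when s ≥ 1.
    exactDiff-^-prime : ∀ {s a b} → p ℕ.∣ (p choose 2) ℕ.* p ℕ.^ s → ¬ P ∣ a →
      ExactDiff p (suc s) a b → ExactDiff p (suc (suc s)) (a ^ p) (b ^ p)
    exactDiff-^-prime {s} {a} p∣tB p∤a (exactDiff u refl p∤u)
      with X , expand ← binomial-quadratic p a (P ^ suc s * u) (ℕ.nonTrivial⇒n>1 p {{prime⇒nonTrivial isPrime}})
         | divides h tB≡hP ← subst (P ∣_) (trans (pos-* (p choose 2) _) (cong (+ (p choose 2) *_) (pos-^ p s))) (∣ᵤ⇒∣ p∣tB) =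
      exactDiff w (begin
          (a + P * B * u) ^ p
            ≡⟨ expand ⟩
          a ^ p + P * A₁ * (P * B * u) + t * A₂ * (P * B * u) * (P * B * u) + X * (P * B * u) * (P * B * u) * (P * B * u)
            ≡⟨ isolate (a ^ p) P B u A₁ A₂ t X ⟩
          a ^ p + P * (P * B) * (A₁ * u + X * B * B * u * u * u * P) + (t * B) * (P * P * B * u * u * A₂)
            ≡⟨ cong (λ e → a ^ p + P * (P * B) * (A₁ * u + X * B * B * u * u * u * P) + e * (P * P * B * u * u * A₂)) tB≡hP ⟩
          a ^ p + P * (P * B) * (A₁ * u + X * B * B * u * u * u * P) + (h * P) * (P * P * B * u * u * A₂)
            ≡⟨ collect (a ^ p) P B u A₁ A₂ h X ⟩
          a ^ p + P * (P * B) * w ∎)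
        (∤-+∣ (∤-* (∤-^ (p ℕ.∸ 1) p∤a) p∤u) (∣n⇒∣m*n (h * A₂ * u * u + X * B * B * u * u * u) ∣-refl))
      where
        B = P ^ s
        t = + (p choose 2)
        A₁ = a ^ (p ℕ.∸ 1)
        A₂ = a ^ (p ℕ.∸ 2)
        w = A₁ * u + (h * A₂ * u * u + X * B * B * u * u * u) * P
        isolate : ∀ ap P B u A₁ A₂ t X →
          ap + P * A₁ * (P * B * u) + t * A₂ * (P * B * u) * (P * B * u) + X * (P * B * u) * (P * B * u) * (P * B * u)
          ≡ ap + P * (P * B) * (A₁ * u + X * B * B * u * u * u * P) + (t * B) * (P * P * B * u * u * A₂)
        isolate = solve-∀
        collect : ∀ ap P B u A₁ A₂ h X →
          ap + P * (P * B) * (A₁ * u + X * B * B * u * u * u * P) + (h * P) * (P * P * B * u * u * A₂)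
          ≡ ap + P * (P * B) * (A₁ * u + (h * A₂ * u * u + X * B * B * u * u * u) * P)
        collect = solve-∀

    exactDiff-^-primePower : ∀ {s a b} k → (0 ℕ.< k → p ℕ.∣ (p choose 2) ℕ.* p ℕ.^ s) → ¬ P ∣ a →
      ExactDiff p (suc s) a b → ExactDiff p (suc (s ℕ.+ k)) (a ^ (p ℕ.^ k)) (b ^ (p ℕ.^ k))
    exactDiff-^-primePower {s} {a} {b} zero _ _ d =
      ExactDiff-resp (cong suc (sym (ℕ.+-identityʳ s))) (sym (^-identityʳ a)) (sym (^-identityʳ b)) d
    exactDiff-^-primePower {s} {a} {b} (suc k) lifts p∤a d =
      ExactDiff-resp (cong suc (sym (ℕ.+-suc s k))) (^-*-assoc a p (p ℕ.^ k)) (^-*-assoc b p (p ℕ.^ k))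
        (exactDiff-^-primePower k (λ _ → ℕ.∣n⇒∣m*n (p choose 2) (ℕ.∣m⇒∣m*n (p ℕ.^ s) ℕ.∣-refl)) (∤-^ p p∤a)
          (exactDiff-^-prime (lifts (s≤s z≤n)) p∤a d))

    exactDiff-^ : ∀ {s a b} q k → ¬ p ℕ.∣ q → (0 ℕ.< k → p ℕ.∣ (p choose 2) ℕ.* p ℕ.^ s) → ¬ P ∣ a →
      ExactDiff p (suc s) a b → ExactDiff p (suc (s ℕ.+ k)) (a ^ (q ℕ.* p ℕ.^ k)) (b ^ (q ℕ.* p ℕ.^ k))
    exactDiff-^ {s} {a} {b} q k p∤q lifts p∤a d =
      subst₂ (ExactDiff p (suc (s ℕ.+ k))) (^-*-assoc a q (p ℕ.^ k)) (^-*-assoc b q (p ℕ.^ k))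
        (exactDiff-^-primePower k lifts (∤-^ q p∤a) (exactDiff-^-coprime q p∤q p∤a d))

    exactDiff-powers : ∀ {s y₁ y₂} q k → ¬ p ℕ.∣ q → (0 ℕ.< k → p ℕ.∣ (p choose 2) ℕ.* p ℕ.^ s) → ¬ p ℕ.∣ y₁ →
      ExactDiff p (suc s) (+ y₁) (+ y₂) → ExactDiff p (suc (s ℕ.+ k)) (+ (y₁ ℕ.^ (q ℕ.* p ℕ.^ k))) (+ (y₂ ℕ.^ (q ℕ.* p ℕ.^ k)))
    exactDiff-powers {s} {y₁} {y₂} q k p∤q lifts p∤y₁ d =
      subst₂ (ExactDiff p (suc (s ℕ.+ k))) (sym (pos-^ y₁ (q ℕ.* p ℕ.^ k))) (sym (pos-^ y₂ (q ℕ.* p ℕ.^ k)))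
        (exactDiff-^ q k p∤q lifts (∤-pos p∤y₁) d)

    exactDiff-evenPowers : ∀ {s y₁ y₂} q k c → q ℕ.* p ℕ.^ k ≡ 2 ℕ.* c → ¬ p ℕ.∣ q →
      (0 ℕ.< k → p ℕ.∣ (p choose 2) ℕ.* p ℕ.^ s) → ¬ p ℕ.∣ y₁ →
      ExactDiff p (suc s) (+ y₁) (- + y₂) → ExactDiff p (suc (s ℕ.+ k)) (+ (y₁ ℕ.^ (q ℕ.* p ℕ.^ k))) (+ (y₂ ℕ.^ (q ℕ.* p ℕ.^ k)))
    exactDiff-evenPowers {s} {y₁} {y₂} q k c even p∤q lifts p∤y₁ d =
      subst₂ (ExactDiff p (suc (s ℕ.+ k))) (sym (pos-^ y₁ (q ℕ.* p ℕ.^ k))) evenPower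
        (exactDiff-^ q k p∤q lifts (∤-pos p∤y₁) d)
      where
        evenPower : (- + y₂) ^ (q ℕ.* p ℕ.^ k) ≡ + (y₂ ℕ.^ (q ℕ.* p ℕ.^ k))
        evenPower = begin
          (- + y₂) ^ (q ℕ.* p ℕ.^ k)  ≡⟨ cong ((- + y₂) ^_) even ⟩
          (- + y₂) ^ (2 ℕ.* c)         ≡⟨ ^-even (+ y₂) c ⟩
          (+ y₂) ^ (2 ℕ.* c)           ≡⟨ cong ((+ y₂) ^_) even ⟨
          (+ y₂) ^ (q ℕ.* p ℕ.^ k)    ≡⟨ pos-^ y₂ (q ℕ.* p ℕ.^ k) ⟨
          + (y₂ ℕ.^ (q ℕ.* p ℕ.^ k))  ∎

  pos-^-* : ∀ p e W → + (p ℕ.^ e ℕ.* W) ≡ (+ p) ^ e * + W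
  pos-^-* p e W = trans (pos-* (p ℕ.^ e) W) (cong (_* + W) (pos-^ p e))

  exactDiff-pos : ∀ {p e Y₁ Y₂ W} → Y₂ ≡ Y₁ ℕ.+ p ℕ.^ e ℕ.* W → ¬ p ℕ.∣ W → ExactDiff p e (+ Y₁) (+ Y₂)
  exactDiff-pos {p} {e} {Y₁} {W = W} refl p∤W =
    exactDiff (+ W) (trans (pos-+ Y₁ _) (cong (λ z → + Y₁ + z) (pos-^-* p e W))) (λ p∣W → p∤W (∣⇒∣ᵤ p∣W))

  exactDiff-neg : ∀ {p e Y₁ Y₂ W} → Y₁ ℕ.+ Y₂ ≡ p ℕ.^ e ℕ.* W → ¬ p ℕ.∣ W → ExactDiff p e (+ Y₁) (- + Y₂)
  exactDiff-neg {p} {e} {Y₁} {Y₂} {W} sum p∤W =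
    exactDiff (- + W) (begin
        - + Y₂                          ≡⟨ cancel (+ Y₁) (+ Y₂) ⟩
        + Y₁ + - (+ Y₁ + + Y₂)          ≡⟨ cong (λ z → + Y₁ + - z) (trans (sym (pos-+ Y₁ Y₂)) (trans (cong +_ sum) (pos-^-* p e W))) ⟩
        + Y₁ + - ((+ p) ^ e * + W)      ≡⟨ cong (λ z → + Y₁ + z) (neg-distribʳ-* ((+ p) ^ e) (+ W)) ⟩
        + Y₁ + (+ p) ^ e * - + W        ∎)
      (λ p∣-W → p∤W (subst (p ℕ.∣_) (∣-i∣≡∣i∣ (+ W)) (∣⇒∣ᵤ p∣-W)))
    where cancel : ∀ y₁ y₂ → - y₂ ≡ y₁ + - (y₁ + y₂)
          cancel = solve-∀

  exactDiff⇒ℕ : ∀ {p e Y₁ Y₂} → Y₁ ℕ.≤ Y₂ → ExactDiff p e (+ Y₁) (+ Y₂) →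
    ∃[ W ] Y₂ ≡ Y₁ ℕ.+ p ℕ.^ e ℕ.* W × ¬ p ℕ.∣ W
  exactDiff⇒ℕ {p} {e} {Y₁} {Y₂} Y₁≤Y₂ (exactDiff w eq p∤w) =
    ∣ w ∣ , trans (sym (ℕ.m+[n∸m]≡n Y₁≤Y₂)) (cong (Y₁ ℕ.+_) gap) , λ p∣w → p∤w (∣ᵤ⇒∣ p∣w)
    where
      cancel : ∀ y c → c ≡ - y + (y + c)
      cancel = solve-∀
      gap : Y₂ ℕ.∸ Y₁ ≡ p ℕ.^ e ℕ.* ∣ w ∣
      gap = begin
        Y₂ ℕ.∸ Y₁                  ≡⟨ cong ∣_∣ (begin
            + (Y₂ ℕ.∸ Y₁)                ≡⟨ ⊖-≥ Y₁≤Y₂ ⟨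
            Y₂ ⊖ Y₁                      ≡⟨ -m+n≡n⊖m Y₁ Y₂ ⟨
            - + Y₁ + + Y₂                ≡⟨ cong (λ z → - + Y₁ + z) eq ⟩
            - + Y₁ + (+ Y₁ + (+ p) ^ e * w) ≡⟨ cancel (+ Y₁) _ ⟨
            (+ p) ^ e * w                ∎) ⟩
        ∣ (+ p) ^ e * w ∣          ≡⟨ abs-* ((+ p) ^ e) w ⟩
        ∣ (+ p) ^ e ∣ ℕ.* ∣ w ∣    ≡⟨ cong (λ z → ∣ z ∣ ℕ.* ∣ w ∣) (pos-^ p e) ⟨
        p ℕ.^ e ℕ.* ∣ w ∣          ∎

open import Defs
open import Data.Integer using (+_; -_)
open import Data.Nat using (ℕ; zero; suc; _+_; _*_; _∸_; _^_; _≤_; _<_; z≤n; s≤s; s<s⁻¹; NonZero; >-nonZero)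
open import Data.Nat.Properties
open import Data.Nat.DivMod using (_/_; _%_; m≡m%n+[m/n]*n; +-distrib-/-∣ʳ; m*n/n≡m; /-congˡ; /-congʳ; m*n/m*o≡n/o)
open import Data.Nat.Divisibility
  using (_∣_; divides; _∣?_; ∣-trans; ∣-refl; m∣m*n; n∣m*n; ∣m⇒∣m*n; ∣n⇒∣m*n; ∣m+n∣m⇒∣n; ∣m∣n⇒∣m+n; *-cancelˡ-∣; ∣⇒≤)
open import Data.Nat.Combinatorics using () renaming (_C_ to _choose_)
open import Data.Nat.Induction using (<-wellFounded)
open import Data.Nat.Primality using (Prime; euclidsLemma; prime⇒nonZero; ¬prime[0]; ¬prime[1]; prime[2])
open import Data.Nat.Tactic.RingSolver using (solve-∀)
open import Data.Fin as Fin using (Fin; toℕ)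
open import Data.Fin.Properties using (toℕ-injective; toℕ-fromℕ<; toℕ<n; any?; punchOut-injective; injective⇒≤)
open import Data.Product using (_×_; _,_; ∃-syntax; ∃₂)
open import Data.Sum using (inj₁; inj₂)
open import Function.Base using (_∘_)
open import Function.Definitions using (Injective; Surjective; Bijective)
open import Induction.WellFounded using (Acc; acc)
open import Relation.Nullary using (¬_; yes; no; contradiction)
open import Relation.Binary.PropositionalEquality
open ≡-Reasoning
open LiftingTheExponent

double-choose-2 : ∀ n → 2 * (suc n choose 2) ≡ suc n * n
double-choose-2 zero    = refl
double-choose-2 (suc n) = begin
  2 * (suc (suc n) choose 2)        ≡⟨ cong (2 *_) (suc-choose-2 (suc n)) ⟩
  2 * (suc n + suc n choose 2)      ≡⟨ *-distribˡ-+ 2 (suc n) (suc n choose 2) ⟩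
  2 * suc n + 2 * (suc n choose 2)  ≡⟨ cong (_+_ (2 * suc n)) (double-choose-2 n) ⟩
  2 * suc n + suc n * n             ≡⟨ regroup n ⟩
  suc (suc n) * suc n               ∎
  where regroup : ∀ n → 2 * (1 + n) + (1 + n) * n ≡ (2 + n) * (1 + n)
        regroup = solve-∀

oddPrime∣choose-2 : ∀ {p} → Prime p → 2 < p → p ∣ p choose 2
oddPrime∣choose-2 {suc n} isPrime 2<p with euclidsLemma 2 (suc n choose 2) isPrime (divides n (trans (double-choose-2 n) (*-comm (suc n) n)))
... | inj₁ p∣2 = contradiction (∣⇒≤ p∣2) (<⇒≱ 2<p)
... | inj₂ p∣C2 = p∣C2

factorisation : ∀ {p} → 1 < p → ∀ z → .{{NonZero z}} → ∃₂ λ s u → z ≡ p ^ s * u × ¬ p ∣ u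
factorisation {p} 1<p z = go z (<-wellFounded z)
  where
    go : ∀ z → Acc _<_ z → .{{NonZero z}} → ∃₂ λ s u → z ≡ p ^ s * u × ¬ p ∣ u
    go z (acc smaller) with p ∣? z
    ... | no p∤z = 0 , z , sym (*-identityˡ z) , p∤z
    ... | yes (divides c@(suc _) refl)
      with s , u , c≡ , p∤u ← go c (smaller (m<m*n c p 1<p)) =
        suc s , u , trans (cong (_* p) c≡) (regroup (p ^ s) u p) , p∤u
      where regroup : ∀ a b c → a * b * c ≡ c * a * b
            regroup = solve-∀

exponent-below : ∀ {p s u l} .{{_ : NonZero p}} .{{_ : NonZero u}} → p ^ s * u < p ^ l → s < l
exponent-below {p} {s} {u} pˢu<pˡ = ≰⇒> λ l≤s → <⇒≱ pˢu<pˡ (≤-trans (^-monoʳ-≤ p l≤s) (m≤m*n (p ^ s) u))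

factorisation-below : ∀ {p l} → 1 < p → ∀ z → .{{NonZero z}} → z < p ^ l →
  ∃₂ λ s u → z ≡ p ^ s * u × ¬ p ∣ u × s < l
factorisation-below {p@(suc _)} {l} 1<p z z<pˡ with factorisation 1<p z
... | s , zero    , _  , p∤0 = contradiction (divides 0 refl) p∤0
... | s , u@(suc _) , z≡ , p∤u = s , u , z≡ , p∤u , exponent-below (subst (_< p ^ l) z≡ z<pˡ)

^-distribʳ-* : ∀ a b n → (a * b) ^ n ≡ a ^ n * b ^ n
^-distribʳ-* a b zero    = refl
^-distribʳ-* a b (suc n) = trans (cong (a * b *_) (^-distribʳ-* a b n)) (interchange a b (a ^ n) (b ^ n))
  where interchange : ∀ a b c d → a * b * (c * d) ≡ a * c * (b * d)
        interchange = solve-∀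

^-monoʳ-∣ : ∀ p {m n} → m ≤ n → p ^ m ∣ p ^ n
^-monoʳ-∣ p {m} m≤n = subst (p ^ m ∣_) (trans (sym (^-distribˡ-+-* p m _)) (cong (p ^_) (m+[n∸m]≡n m≤n))) (m∣m*n _)

%≡%⇒∣∸ : ∀ N .{{_ : NonZero N}} Y₁ Y₂ → Y₁ % N ≡ Y₂ % N → N ∣ Y₂ ∸ Y₁
%≡%⇒∣∸ N Y₁ Y₂ same = divides (Y₂ / N ∸ Y₁ / N) (begin
  Y₂ ∸ Y₁                                       ≡⟨ cong₂ _∸_ (m≡m%n+[m/n]*n Y₂ N) (m≡m%n+[m/n]*n Y₁ N) ⟩
  (Y₂ % N + Y₂ / N * N) ∸ (Y₁ % N + Y₁ / N * N) ≡⟨ cong (λ z → (Y₂ % N + Y₂ / N * N) ∸ (z + Y₁ / N * N)) same ⟩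
  (Y₂ % N + Y₂ / N * N) ∸ (Y₂ % N + Y₁ / N * N) ≡⟨ [m+n]∸[m+o]≡n∸o (Y₂ % N) _ _ ⟩
  Y₂ / N * N ∸ Y₁ / N * N                       ≡⟨ *-distribʳ-∸ N (Y₂ / N) (Y₁ / N) ⟨
  (Y₂ / N ∸ Y₁ / N) * N                         ∎)

digitBlock : ∀ p .{{_ : NonZero p}} (m l Y : ℕ) → ℕ
digitBlock p m l Y = (Y / p ^ m) % p ^ l
  where instance
    pᵐ≢0 = m^n≢0 p m
    pˡ≢0 = m^n≢0 p l

digitBlock-≢ : ∀ p .{{_ : NonZero p}} m l i Y W → i < l → ¬ p ∣ W →
  digitBlock p m l Y ≢ digitBlock p m l (Y + p ^ (m + i) * W)
digitBlock-≢ p m l i Y W i<l p∤W same = p∤W (*-cancelˡ-∣ (p ^ i) (∣-trans pⁱp∣pˡ pˡ∣pⁱW))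
  where
    instance
      pᵐ≢0 = m^n≢0 p m
      pˡ≢0 = m^n≢0 p l
      pⁱ≢0 = m^n≢0 p i
    shift : (Y + p ^ (m + i) * W) / p ^ m ≡ Y / p ^ m + p ^ i * W
    shift = begin
      (Y + p ^ (m + i) * W) / p ^ m      ≡⟨ +-distrib-/-∣ʳ Y (∣m⇒∣m*n W (^-monoʳ-∣ p (m≤m+n m i))) ⟩
      Y / p ^ m + p ^ (m + i) * W / p ^ m ≡⟨ cong (λ z → Y / p ^ m + z / p ^ m) (trans (cong (_* W) (^-distribˡ-+-* p m i)) (regroup (p ^ m) (p ^ i) W)) ⟩
      Y / p ^ m + p ^ i * W * p ^ m / p ^ m ≡⟨ cong (_+_ (Y / p ^ m)) (m*n/n≡m (p ^ i * W) (p ^ m)) ⟩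
      Y / p ^ m + p ^ i * W               ∎
      where regroup : ∀ a b c → a * b * c ≡ b * c * a
            regroup = solve-∀
    pˡ∣pⁱW : p ^ l ∣ p ^ i * W
    pˡ∣pⁱW = subst (p ^ l ∣_) (m+n∸m≡n (Y / p ^ m) (p ^ i * W))
               (%≡%⇒∣∸ (p ^ l) _ _ (trans same (cong (_% p ^ l) shift)))
    pⁱp∣pˡ : p ^ i * p ∣ p ^ l
    pⁱp∣pˡ = subst (_∣ p ^ l) (*-comm p (p ^ i)) (^-monoʳ-∣ p i<l)

α₀ : ℕ → ℕ → ℕ
α₀ k p = 1 + k + δ p 2 * (1 ∸ δ k 0)

α′≡j*n+α₀ : ∀ n j k p → α′ n j k p ≡ j * n + α₀ k p
α′≡j*n+α₀ n j k p = regroup n j k (δ p 2 * (1 ∸ δ k 0))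
  where regroup : ∀ n j k d → n * j + 1 + k + d ≡ j * n + (1 + k + d)
        regroup = solve-∀

Cℕ≡digitBlock : ∀ p .{{_ : NonZero p}} n j k l r x → Cℕ p n j k l r x ≡ digitBlock p (α₀ k p) l ((p * x + r) ^ n)
Cℕ≡digitBlock p n j k l r x = cong (_% p ^ l) (begin
  (p ^ j * y) ^ n / p ^ α′ n j k p              ≡⟨ /-congˡ {o = p ^ α′ n j k p} (^-distribʳ-* (p ^ j) y n) ⟩
  (p ^ j) ^ n * y ^ n / p ^ α′ n j k p          ≡⟨ /-congˡ {o = p ^ α′ n j k p} (cong (_* y ^ n) (^-*-assoc p j n)) ⟩
  p ^ (j * n) * y ^ n / p ^ α′ n j k p          ≡⟨ /-congʳ (trans (cong (p ^_) (α′≡j*n+α₀ n j k p)) (^-distribˡ-+-* p (j * n) (α₀ k p))) ⟩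
  p ^ (j * n) * y ^ n / (p ^ (j * n) * p ^ α₀ k p) ≡⟨ m*n/m*o≡n/o (p ^ (j * n)) (y ^ n) (p ^ α₀ k p) ⟩
  y ^ n / p ^ α₀ k p                            ∎)
  where
    y = p * x + r
    instance
      pˡ≢0 = m^n≢0 p l
      pᵅ≢0 = m^n≢0 p (α′ n j k p)
      pᵅ₀≢0 = m^n≢0 p (α₀ k p)
      pʲⁿ≢0 = m^n≢0 p (j * n)
      pʲⁿpᵅ₀≢0 = m*n≢0 (p ^ (j * n)) (p ^ α₀ k p)

∤-affine : ∀ {p r} x → 0 < r → r < p → ¬ p ∣ p * x + r
∤-affine x 0<r r<p p∣px+r = <⇒≱ r<p (∣⇒≤ {{>-nonZero 0<r}} (∣m+n∣m⇒∣n p∣px+r (m∣m*n x)))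

affine-exactDiff : ∀ {p r x₁ x₂ s u} → x₁ ≤ x₂ → x₂ ∸ x₁ ≡ p ^ s * u → ¬ p ∣ u →
  ExactDiff p (suc s) (+ (p * x₁ + r)) (+ (p * x₂ + r))
affine-exactDiff {p} {r} {x₁} {x₂} {s} {u} x₁≤x₂ gap p∤u = exactDiff-pos (begin
  p * x₂ + r                     ≡⟨ cong (λ x → p * x + r) (trans (sym (m+[n∸m]≡n x₁≤x₂)) (cong (_+_ x₁) gap)) ⟩
  p * (x₁ + p ^ s * u) + r       ≡⟨ regroup p x₁ r (p ^ s) u ⟩
  p * x₁ + r + p * p ^ s * u     ∎) p∤u
  where regroup : ∀ p x r a u → p * (x + a * u) + r ≡ p * x + r + p * a * u
        regroup = solve-∀

2∣suc : ∀ d → ¬ 2 ∣ d → 2 ∣ suc d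
2∣suc zero          2∤0 = contradiction (divides 0 refl) 2∤0
2∣suc (suc zero)    _   = divides 1 refl
2∣suc (suc (suc d)) 2∤d = ∣m∣n⇒∣m+n ∣-refl (2∣suc d (λ 2∣d → 2∤d (∣m∣n⇒∣m+n ∣-refl 2∣d)))

1+x₁+x₂-even : ∀ {x₁ x₂} → x₁ ≤ x₂ → ¬ 2 ∣ x₂ ∸ x₁ → 2 ∣ suc (x₁ + x₂)
1+x₁+x₂-even {x₁} {x₂} x₁≤x₂ 2∤x₂-x₁ = subst (2 ∣_) (begin
  x₁ * 2 + suc (x₂ ∸ x₁)       ≡⟨ regroup x₁ (x₂ ∸ x₁) ⟩
  suc (x₁ + (x₁ + (x₂ ∸ x₁)))  ≡⟨ cong (λ z → suc (x₁ + z)) (m+[n∸m]≡n x₁≤x₂) ⟩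
  suc (x₁ + x₂)                ∎) (∣m∣n⇒∣m+n (n∣m*n x₁) (2∣suc (x₂ ∸ x₁) 2∤x₂-x₁))
  where regroup : ∀ x d → x * 2 + suc d ≡ suc (x + (x + d))
        regroup = solve-∀

1+x₁+x₂<2b : ∀ {x₁ x₂ b} → x₁ < x₂ → x₂ < b → suc (x₁ + x₂) < 2 * b
1+x₁+x₂<2b {x₁} {x₂} {b} x₁<x₂ x₂<b =
  subst₂ _<_ (+-suc x₁ x₂) (cong (_+_ b) (sym (+-identityʳ b))) (+-mono-<-≤ (<-trans x₁<x₂ x₂<b) x₂<b)

-- Here y₂ − y₁ ≡ 2 (mod 4), so y₁ + y₂ = y₁ − (−y₂) is the difference that lifts.
power-gap-2 : ∀ {q k l r x₁ x₂} → ¬ 2 ∣ q → 0 < r → r < 2 → x₁ < x₂ → x₂ < 2 ^ l → ¬ 2 ∣ x₂ ∸ x₁ →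
  ∃[ i ] i < l × ExactDiff 2 (α₀ (suc k) 2 + i) (+ ((2 * x₁ + r) ^ (q * 2 ^ suc k))) (+ ((2 * x₂ + r) ^ (q * 2 ^ suc k)))
power-gap-2 {r = zero}        _ () _
power-gap-2 {r = suc (suc _)} _ _  (s≤s (s≤s ()))
power-gap-2 {q} {k} {l} {suc zero} {x₁} {x₂} 2∤q 0<r r<2 x₁<x₂ x₂<2ˡ 2∤x₂-x₁
  with factorisation-below (s≤s (s≤s z≤n)) (suc (x₁ + x₂)) (1+x₁+x₂<2b x₁<x₂ x₂<2ˡ)
... | zero , u , sum≡ , 2∤u , _ =
  contradiction (subst (2 ∣_) (trans sum≡ (*-identityˡ u)) (1+x₁+x₂-even (<⇒≤ x₁<x₂) 2∤x₂-x₁)) 2∤u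
... | suc s , u , sum≡ , 2∤u , s<l =
  s , s<s⁻¹ s<l ,
  ExactDiff-resp (exponent s k) refl refl
    (exactDiff-evenPowers prime[2] q (suc k) (q * 2 ^ k) (even q (2 ^ k)) 2∤q
      (λ _ → ∣n⇒∣m*n (2 choose 2) (∣m⇒∣m*n (2 ^ s) ∣-refl)) (∤-affine x₁ 0<r r<2) (exactDiff-neg ysum 2∤u))
  where
    exponent : ∀ s k → suc (suc s + suc k) ≡ 1 + suc k + 1 + s
    exponent = solve-∀
    even : ∀ q a → q * (2 * a) ≡ 2 * (q * a)
    even = solve-∀
    double : ∀ a b → (2 * a + 1) + (2 * b + 1) ≡ 2 * (1 + (a + b))
    double = solve-∀
    ysum : (2 * x₁ + 1) + (2 * x₂ + 1) ≡ 2 ^ suc (suc s) * u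
    ysum = trans (double x₁ x₂) (trans (cong (2 *_) sum≡) (sym (*-assoc 2 (2 ^ suc s) u)))

power-gap : ∀ {p n q k l r x₁ x₂} → Prime p → n ≡ q * p ^ k → ¬ p ∣ q → 0 < r → r < p → x₁ < x₂ → x₂ < p ^ l →
  ∃[ i ] i < l × ExactDiff p (α₀ k p + i) (+ ((p * x₁ + r) ^ n)) (+ ((p * x₂ + r) ^ n))
power-gap {zero}      isPrime = contradiction isPrime ¬prime[0]
power-gap {suc zero}  isPrime = contradiction isPrime ¬prime[1]
power-gap {suc (suc m)} {l = l} {x₁ = x₁} {x₂} isPrime refl p∤q 0<r r<p x₁<x₂ x₂<pˡ
  with factorisation-below {suc (suc m)} {l} (s≤s (s≤s z≤n)) (x₂ ∸ x₁) {{>-nonZero (m<n⇒0<n∸m x₁<x₂)}} (≤-<-trans (m∸n≤m x₂ x₁) x₂<pˡ)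
power-gap {suc (suc (suc m))} {q = q} {k} {x₁ = x₁} isPrime refl p∤q 0<r r<p x₁<x₂ _ | s , u , gap , p∤u , s<l =
  s , s<l , ExactDiff-resp (exponent s k) refl refl
    (exactDiff-powers isPrime q k p∤q (λ _ → ∣m⇒∣m*n _ (oddPrime∣choose-2 isPrime (s≤s (s≤s (s≤s z≤n)))))
      (∤-affine x₁ 0<r r<p) (affine-exactDiff (<⇒≤ x₁<x₂) gap p∤u))
  where exponent : ∀ s k → suc (s + k) ≡ 1 + k + 0 + s
        exponent = solve-∀
power-gap {2} {q = q} {zero} {x₁ = x₁} isPrime refl p∤q 0<r r<p x₁<x₂ _ | s , u , gap , p∤u , s<l =
  s , s<l , ExactDiff-resp (cong suc (+-identityʳ s)) refl refl
    (exactDiff-powers isPrime q 0 p∤q (λ ()) (∤-affine x₁ 0<r r<p) (affine-exactDiff (<⇒≤ x₁<x₂) gap p∤u))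
power-gap {2} {q = q} {suc k} {x₁ = x₁} isPrime refl p∤q 0<r r<p x₁<x₂ _ | suc s , u , gap , p∤u , s<l =
  s , <-trans (n<1+n s) s<l , ExactDiff-resp (exponent s k) refl refl
    (exactDiff-powers isPrime q (suc k) p∤q (λ _ → ∣n⇒∣m*n (2 choose 2) (∣m⇒∣m*n (2 ^ s) ∣-refl))
      (∤-affine x₁ 0<r r<p) (affine-exactDiff (<⇒≤ x₁<x₂) gap p∤u))
  where exponent : ∀ s k → suc (suc s + suc k) ≡ 1 + suc k + 1 + s
        exponent = solve-∀
power-gap {2} {k = suc k} isPrime refl p∤q 0<r r<p x₁<x₂ x₂<pˡ | zero , u , gap , p∤u , _ =
  power-gap-2 p∤q 0<r r<p x₁<x₂ x₂<pˡ (λ 2∣x₂-x₁ → p∤u (subst (2 ∣_) (trans gap (*-identityˡ u)) 2∣x₂-x₁))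

Cℕ-≢ : ∀ {p n q x₁ x₂} j k l r (isPrime : Prime p) → n ≡ q * p ^ k → ¬ p ∣ q → 0 < r → r < p →
  x₁ < x₂ → x₂ < p ^ l → Cℕ p n j k l r x₁ {{prime⇒nonZero isPrime}} ≢ Cℕ p n j k l r x₂ {{prime⇒nonZero isPrime}}
Cℕ-≢ {p} {n} {x₁ = x₁} {x₂} j k l r isPrime hn p∤q 0<r r<p x₁<x₂ x₂<pˡ same
  with i , i<l , gap ← power-gap {k = k} isPrime hn p∤q 0<r r<p x₁<x₂ x₂<pˡ
  with W , Y₂≡ , p∤W ← exactDiff⇒ℕ (^-monoˡ-≤ n (+-monoˡ-≤ r (*-monoʳ-≤ p (<⇒≤ x₁<x₂)))) gap =
    digitBlock-≢ p (α₀ k p) l i ((p * x₁ + r) ^ n) W i<l p∤W (begin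
      digitBlock p (α₀ k p) l ((p * x₁ + r) ^ n)  ≡⟨ Cℕ≡digitBlock p n j k l r x₁ ⟨
      Cℕ p n j k l r x₁                           ≡⟨ same ⟩
      Cℕ p n j k l r x₂                           ≡⟨ Cℕ≡digitBlock p n j k l r x₂ ⟩
      digitBlock p (α₀ k p) l ((p * x₂ + r) ^ n)  ≡⟨ cong (digitBlock p (α₀ k p) l) Y₂≡ ⟩
      digitBlock p (α₀ k p) l ((p * x₁ + r) ^ n + p ^ (α₀ k p + i) * W) ∎)
  where instance _ = prime⇒nonZero isPrime

C-injective : ∀ {p n q} j k l r (isPrime : Prime p) → n ≡ q * p ^ k → ¬ p ∣ q → 0 < r → r < p →
  Injective _≡_ _≡_ (C p n j k l r {{prime⇒nonZero isPrime}})
C-injective {p} {n} j k l r isPrime hn p∤q 0<r r<p {x₁} {x₂} Cx₁≡Cx₂ =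
  toℕ-injective (≤-antisym (≮⇒≥ (¬< x₂ x₁ (sym sameℕ))) (≮⇒≥ (¬< x₁ x₂ sameℕ)))
  where
    instance _ = prime⇒nonZero isPrime
    ¬< : ∀ x y → Cℕ p n j k l r (toℕ x) ≡ Cℕ p n j k l r (toℕ y) → ¬ toℕ x < toℕ y
    ¬< x y same x<y = Cℕ-≢ j k l r isPrime hn p∤q 0<r r<p x<y (toℕ<n y) same
    sameℕ : Cℕ p n j k l r (toℕ x₁) ≡ Cℕ p n j k l r (toℕ x₂)
    sameℕ = trans (sym (toℕ-fromℕ< _)) (trans (cong toℕ Cx₁≡Cx₂) (toℕ-fromℕ< _))

injective⇒surjective : ∀ {N} {f : Fin N → Fin N} → Injective _≡_ _≡_ f → Surjective _≡_ _≡_ f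
injective⇒surjective {zero}  _ ()
injective⇒surjective {suc N} {f} f-inj y with any? (λ x → f x Fin.≟ y)
... | yes (x , fx≡y) = x , λ { refl → fx≡y }
... | no y∉im = contradiction (injective⇒≤ g-inj) (<-irrefl refl)
  where
    g : Fin (suc N) → Fin N
    g x = Fin.punchOut {i = y} {j = f x} (λ y≡fx → y∉im (x , sym y≡fx))
    g-inj : Injective _≡_ _≡_ g
    g-inj {x₁} {x₂} = f-inj ∘ punchOut-injective (λ y≡fx₁ → y∉im (x₁ , sym y≡fx₁)) (λ y≡fx₂ → y∉im (x₂ , sym y≡fx₂))

corollary1 : (n l p j q k : ℕ) → .{{_ : NonZero n}} → .{{_ : NonZero l}}
    → (pp : Prime p) → n ≡ q * p ^ k → ¬ (p ∣ q)
    → (r : ℕ) → 0 < r → r < p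
    → Bijective _≡_ _≡_ (C p n j k l r {{prime⇒nonZero pp}})
corollary1 n l p j q k pp hn p∤q r 0<r r<p = C-inj , injective⇒surjective C-inj
  where
    C-inj : Injective _≡_ _≡_ (C p n j k l r {{prime⇒nonZero pp}})
    C-inj = C-injective j k l r pp hn p∤q 0<r r<p
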